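{- Let $q>0$ be an integer and let $y_{i,k}$ for $i\in[q]$, $k\in[q]$ be boolean variables, collected in a vector $\mathbf{y}$. Then there exists a polynomial $p$ of degree $q-1$ over the integers modulo $2$ such that, whenever the variables in $\mathbf{y}$ are given a partial choice assignment, $p(\mathbf{y})\equiv 1 \pmod 2$ if and only if both of the following hold: (1) there exist no $i,j,k\in[q]$ with $i\neq j$ such that $y_{i,k}=y_{j,k}=1$; and (2) for every $k\in[q-1]$ there exists $i\in[q]$ such that $y_{i,k}=1$.
   Context: $[n]=\{1,\dots,n\}$. An assignment of values in $\{0,1\}$ to variables $y_{i,k}$ ($i\in[n]$, $k\in[q]$) is a partial choice assignment if $\sum_{k=1}^q y_{i,k}\leq 1$ for every $i\in[n]$ (here $n=q$). -}

module Defs where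

open import Data.Nat using (ℕ; zero; suc; _+_; _*_; _^_; _≤_; _<_)
open import Data.Fin using (Fin; toℕ)
open import Data.Bool using (Bool; true; false; if_then_else_)
open import Data.Vec using (Vec; lookup; foldr; map; tabulate) renaming (sum to vsum)
open import Data.List as List using (List)
open import Data.Nat.ListAction using () renaming (sum to lsum)
open import Data.List.Relation.Unary.All using (All)
open import Data.List.Relation.Unary.Any using (Any)
open import Data.List.Relation.Unary.Unique.Propositional using (Unique)
open import Data.Product using (Σ; ∃; _×_; _,_)
open import Relation.Binary.PropositionalEquality using (_≡_; _≢_)
open import Relation.Nullary using (¬_)

Assignment : ℕ → Set
Assignment q = Fin q → Fin q → Bool

val : Bool → ℕ
val b = if b then 1 else 0

-- A monomial in the variables y_{i,k}: exponent of y_{i,k} is lookup (lookup m i) k.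
Monomial : ℕ → Set
Monomial q = Vec (Vec ℕ q) q

-- A polynomial over GF(2) = ℤ/2: a list of monomials, each with coefficient 1
-- (in normal form the list has no repeated monomials, see HasDegree).
Poly : ℕ → Set
Poly q = List (Monomial q)

monDeg : ∀ {q} → Monomial q → ℕ
monDeg m = vsum (map vsum m)

vprod : ∀ {n} → Vec ℕ n → ℕ
vprod = foldr _ _*_ 1

evalMon : ∀ {q} → Assignment q → Monomial q → ℕ
evalMon {q} y m = vprod (tabulate λ i → vprod (tabulate λ k → val (y i k) ^ lookup (lookup m i) k))

-- integer value of the polynomial; its residue mod 2 is the GF(2) value
evalPoly : ∀ {q} → Assignment q → Poly q → ℕ
evalPoly y p = lsum (List.map (evalMon y) p)

HasDegree : ∀ {q} → Poly q → ℕ → Set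
HasDegree p d = Unique p × All (λ m → monDeg m ≤ d) p × Any (λ m → monDeg m ≡ d) p

PartialChoice : ∀ {q} → Assignment q → Set
PartialChoice {q} y = ∀ (i : Fin q) → vsum (tabulate λ k → val (y i k)) ≤ 1

Cond1 : ∀ {q} → Assignment q → Set
Cond1 {q} y = ¬ (∃ λ (i : Fin q) → ∃ λ (j : Fin q) → ∃ λ (k : Fin q) →
                  i ≢ j × y i k ≡ true × y j k ≡ true)

-- (2) for every k ∈ [q-1] (0-based: toℕ k + 1 < q) there is i with y_{i,k} = 1
Cond2 : ∀ {q} → Assignment q → Set
Cond2 {q} y = ∀ (k : Fin q) → suc (toℕ k) < q → ∃ λ (i : Fin q) → y i k ≡ true

-- The polynomial is the expansion of ∏_{k<q-1} ∑_i y_{i,k}: one monomial ∏_k y_{f(k),k}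
-- for each choice f of a row in every one of the first q-1 columns. Hence it has degree
-- q-1, and it is odd exactly when each of these column sums is odd.
-- A partial choice assignment has at most q ones. If the first q-1 column sums are odd,
-- they are at least 1 each, so a column holding two ones (hence three, if it is among
-- the first q-1) would push the total to q+1. So (1) holds, and the odd column sums are
-- positive, which is (2). Conversely, (1) and (2) make each of the first q-1 column sums 1.
module Submission where

open import Defs
import Algebra.Properties.CommutativeMonoid.Sum as CommutativeMonoidSum
open import Data.Bool using (Bool; true; false)
open import Data.Empty using (⊥-elim)
open import Data.Fin using (Fin; zero; suc; fromℕ; inject₁; punchIn; punchOut; _≟_)
open import Data.Fin.Properties using (punchIn-punchOut; toℕ-fromℕ; toℕ-inject₁; toℕ<n)
open import Data.Fin.Relation.Unary.Top using (view; ‵fromℕ; ‵inject₁)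
open import Data.List as List using (List; []; _∷_; allFin; cartesianProductWith)
open import Data.List.Membership.Propositional using (_∈_; lose)
open import Data.List.Membership.Propositional.Properties using (∈-allFin; ∈-map⁺; ∈-cartesianProductWith⁺)
open import Data.List.Properties using (map-++; map-∘; map-cong; map-tabulate)
import Data.List.Relation.Unary.All as All
import Data.List.Relation.Unary.All.Properties as All
open import Data.List.Relation.Unary.AllPairs using ([]; _∷_)
open import Data.List.Relation.Unary.Any using (here)
open import Data.List.Relation.Unary.Unique.Propositional using (Unique)
open import Data.List.Relation.Unary.Unique.Propositional.Properties using (cartesianProductWith⁺; allFin⁺; map⁺)
open import Data.Nat using (ℕ; zero; suc; _+_; _*_; _^_; _≤_; _<_; _∸_; _%_; z≤n; s≤s)
open import Data.Nat.DivMod using (%-distribˡ-*; m%n<n)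
open import Data.Nat.ListAction using () renaming (sum to lsum)
open import Data.Nat.ListAction.Properties using (sum-++)
open import Data.Nat.Properties
  using (+-0-commutativeMonoid; *-1-commutativeMonoid; <-irrefl; +-comm; +-identityʳ; *-identityʳ; *-zeroʳ;
         *-distribˡ-+; *-distribʳ-+; ≤-trans; ≤-reflexive; m≤m+n; +-mono-≤; +-monoˡ-≤; +-monoʳ-≤; module ≤-Reasoning)
open import Data.Product using (Σ; ∃; _×_; _,_; proj₁; proj₂)
open import Data.Vec as Vec using (Vec; []; _∷_; lookup; tabulate) renaming (sum to vsum)
open import Data.Vec.Properties using (∷-injective; lookup∘tabulate; tabulate-∘)
import Data.Vec.Functional as Vector
open import Function.Bundles using (_⇔_; mk⇔)
open import Function.Construct.Composition using (_⇔-∘_)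
open import Relation.Binary.PropositionalEquality using (_≡_; _≢_; refl; sym; trans; cong; cong₂; subst; module ≡-Reasoning)
open import Relation.Nullary using (yes; no; does)
open import Relation.Nullary.Decidable using (dec-true)

private
  module Sum  = CommutativeMonoidSum +-0-commutativeMonoid
  module Prod = CommutativeMonoidSum *-1-commutativeMonoid

∑ : ∀ {n} → (Fin n → ℕ) → ℕ
∑ = Sum.sum

∏ : ∀ {n} → (Fin n → ℕ) → ℕ
∏ = Prod.sum

foldr-tabulate : ∀ (_∙_ : ℕ → ℕ → ℕ) e {n} (f : Fin n → ℕ) →
                 Vec.foldr _ _∙_ e (tabulate f) ≡ Vector.foldr _∙_ e f
foldr-tabulate _∙_ e {zero}  f = refl
foldr-tabulate _∙_ e {suc n} f = cong (f zero ∙_) (foldr-tabulate _∙_ e (λ i → f (suc i)))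

sum-map-allFin : ∀ {n} (f : Fin n → ℕ) → lsum (List.map f (allFin n)) ≡ ∑ f
sum-map-allFin f = trans (cong lsum (map-tabulate (λ i → i) f)) (sum-tabulate f)
  where
  sum-tabulate : ∀ {n} (f : Fin n → ℕ) → lsum (List.tabulate f) ≡ ∑ f
  sum-tabulate {zero}  f = refl
  sum-tabulate {suc n} f = cong (f zero +_) (sum-tabulate (λ i → f (suc i)))

≤-∑ : ∀ {n} (f : Fin (suc n) → ℕ) i → f i ≤ ∑ f
≤-∑ f i = ≤-trans (m≤m+n (f i) _) (≤-reflexive (sym (Sum.sum-remove {i = i} f)))

+-≤-∑ : ∀ {n} (f : Fin (suc n) → ℕ) {i j} → i ≢ j → f i + f j ≤ ∑ f
+-≤-∑ {zero}  f {zero} {zero} i≢i = ⊥-elim (i≢i refl)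
+-≤-∑ {suc n} f {i} {j} i≢j = begin
  f i + f j                                 ≡⟨ cong (λ k → f i + f k) (sym (punchIn-punchOut i≢j)) ⟩
  f i + Vector.removeAt f i (punchOut i≢j)  ≤⟨ +-monoʳ-≤ (f i) (≤-∑ (Vector.removeAt f i) (punchOut i≢j)) ⟩
  f i + ∑ (Vector.removeAt f i)             ≡⟨ sym (Sum.sum-remove f) ⟩
  ∑ f                                       ∎
  where open ≤-Reasoning

∑-pos : ∀ {n} (f : Fin n → ℕ) → 0 < ∑ f → ∃ λ i → 0 < f i
∑-pos {suc n} f p with f zero in eq
... | suc _ = zero , subst (0 <_) (sym eq) (s≤s z≤n)
... | zero with ∑-pos (λ i → f (suc i)) p
...   | i , q = suc i , q

∑-≤-card : ∀ {n} (f : Fin n → ℕ) → (∀ i → f i ≤ 1) → ∑ f ≤ n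
∑-≤-card {zero}  f f≤1 = z≤n
∑-≤-card {suc n} f f≤1 = +-mono-≤ (f≤1 zero) (∑-≤-card (λ i → f (suc i)) (λ i → f≤1 (suc i)))

∑-≥-card : ∀ {n} (f : Fin n → ℕ) → (∀ i → 1 ≤ f i) → n ≤ ∑ f
∑-≥-card {zero}  f 1≤f = z≤n
∑-≥-card {suc n} f 1≤f = +-mono-≤ (1≤f zero) (∑-≥-card (λ i → f (suc i)) (λ i → 1≤f (suc i)))

δ : ∀ {n} → Fin n → Fin n → ℕ
δ i j = val (does (i ≟ j))

δ-diag : ∀ {n} (i : Fin n) → δ i i ≡ 1
δ-diag i = cong val (dec-true (i ≟ i) refl)

δ≡1⇒≡ : ∀ {n} {i j : Fin n} → δ i j ≡ 1 → i ≡ j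
δ≡1⇒≡ {i = i} {j} with i ≟ j
... | yes i≡j = λ _ → i≡j
... | no  _   = λ ()

∑-δ : ∀ {n} (j : Fin n) → ∑ (λ i → δ i j) ≡ 1
∑-δ {suc n} zero    = cong suc (Sum.sum-replicate-zero n)
∑-δ {suc n} (suc j) = ∑-δ j

∏-^-δ : ∀ {n} (g : Fin n → ℕ) (j : Fin n) → ∏ (λ i → g i ^ δ i j) ≡ g j
∏-^-δ {suc n} g zero    = begin
  g zero * 1 * ∏ {n} (λ _ → 1)  ≡⟨ cong (g zero * 1 *_) (Prod.sum-replicate-zero n) ⟩
  g zero * 1 * 1                ≡⟨ trans (*-identityʳ _) (*-identityʳ _) ⟩
  g zero                        ∎
  where open ≡-Reasoning
∏-^-δ {suc n} g (suc j) = trans (+-identityʳ _) (∏-^-δ (λ i → g (suc i)) j)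

val-pos⇒true : ∀ {b} → 0 < val b → b ≡ true
val-pos⇒true {true} _ = refl

∑-val-unique : ∀ {n} (b : Fin n → Bool) i → b i ≡ true → (∀ j → b j ≡ true → j ≡ i) →
               ∑ (λ j → val (b j)) ≡ 1
∑-val-unique b i bi unique = trans (Sum.sum-cong-≗ b≗δ) (∑-δ i)
  where
  b≗δ : ∀ j → val (b j) ≡ δ j i
  b≗δ j with b j in bj
  ... | true rewrite unique j bj = sym (δ-diag i)
  ... | false with j ≟ i
  ...   | no  _    = refl
  ...   | yes refl with () ← trans (sym bj) bi

Odd : ℕ → Set
Odd n = n % 2 ≡ 1

odd⇒pos : ∀ {n} → Odd n → 0 < n
odd⇒pos {suc _} _ = s≤s z≤n

odd-≥2⇒≥3 : ∀ {n} → Odd n → 2 ≤ n → 3 ≤ n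
odd-≥2⇒≥3 {suc zero}          _  (s≤s ())
odd-≥2⇒≥3 {suc (suc zero)}    () _
odd-≥2⇒≥3 {suc (suc (suc _))} _  _ = s≤s (s≤s (s≤s z≤n))

odd-*⁻ : ∀ a b → Odd (a * b) → Odd a × Odd b
odd-*⁻ a b odd
  with a % 2 | m%n<n a 2 | b % 2 | m%n<n b 2 | trans (sym (%-distribˡ-* a b 2)) odd
... | 1           | _            | 1           | _            | _  = refl , refl
... | 0           | _            | _           | _            | ()
... | 1           | _            | 0           | _            | ()
... | suc (suc _) | s≤s (s≤s ()) | _           | _            | _
... | 1           | _            | suc (suc _) | s≤s (s≤s ()) | _

odd-*⁺ : ∀ a b → Odd a → Odd b → Odd (a * b)
odd-*⁺ a b oa ob = trans (%-distribˡ-* a b 2) (cong₂ (λ r s → (r * s) % 2) oa ob)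

∏-odd⁻ : ∀ {n} (f : Fin n → ℕ) → Odd (∏ f) → ∀ k → Odd (f k)
∏-odd⁻ f odd zero    = proj₁ (odd-*⁻ (f zero) _ odd)
∏-odd⁻ f odd (suc k) = ∏-odd⁻ (λ i → f (suc i)) (proj₂ (odd-*⁻ (f zero) _ odd)) k

∏-odd⁺ : ∀ {n} (f : Fin n → ℕ) → (∀ k → Odd (f k)) → Odd (∏ f)
∏-odd⁺ {zero}  f odd = refl
∏-odd⁺ {suc n} f odd = odd-*⁺ (f zero) _ (odd zero) (∏-odd⁺ (λ i → f (suc i)) (λ k → odd (suc k)))

allVecs : ∀ q m → List (Vec (Fin q) m)
allVecs q zero    = [] ∷ []
allVecs q (suc m) = cartesianProductWith _∷_ (allFin q) (allVecs q m)

allVecs-unique : ∀ q m → Unique (allVecs q m)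
allVecs-unique q zero    = All.[] ∷ []
allVecs-unique q (suc m) = cartesianProductWith⁺ _∷_ ∷-injective (allFin⁺ q) (allVecs-unique q m)

∈-allVecs : ∀ {q m} (v : Vec (Fin q) m) → v ∈ allVecs q m
∈-allVecs []      = here refl
∈-allVecs (r ∷ v) = ∈-cartesianProductWith⁺ _∷_ (∈-allFin r) (∈-allVecs v)

sum-map-*ˡ : ∀ {A : Set} c (g : A → ℕ) xs → lsum (List.map (λ x → c * g x) xs) ≡ c * lsum (List.map g xs)
sum-map-*ˡ c g []       = sym (*-zeroʳ c)
sum-map-*ˡ c g (x ∷ xs) = trans (cong (c * g x +_) (sum-map-*ˡ c g xs)) (sym (*-distribˡ-+ c (g x) _))

sum-cartesianProductWith : ∀ {A B C : Set} (f : A → B → C) (w : C → ℕ) (u : A → ℕ) (v : B → ℕ) →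
  (∀ a b → w (f a b) ≡ u a * v b) → ∀ xs ys →
  lsum (List.map w (cartesianProductWith f xs ys)) ≡ lsum (List.map u xs) * lsum (List.map v ys)
sum-cartesianProductWith f w u v w≡u*v []       ys = refl
sum-cartesianProductWith f w u v w≡u*v (x ∷ xs) ys = begin
  lsum (List.map w (List.map (f x) ys List.++ rest))
    ≡⟨ cong lsum (map-++ w (List.map (f x) ys) rest) ⟩
  lsum (List.map w (List.map (f x) ys) List.++ List.map w rest)
    ≡⟨ sum-++ (List.map w (List.map (f x) ys)) _ ⟩
  lsum (List.map w (List.map (f x) ys)) + lsum (List.map w rest)
    ≡⟨ cong₂ _+_ row (sum-cartesianProductWith f w u v w≡u*v xs ys) ⟩
  u x * ∑v + lsum (List.map u xs) * ∑v
    ≡⟨ sym (*-distribʳ-+ ∑v (u x) _) ⟩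
  (u x + lsum (List.map u xs)) * ∑v ∎
  where
  open ≡-Reasoning
  rest = cartesianProductWith f xs ys
  ∑v = lsum (List.map v ys)
  row : lsum (List.map w (List.map (f x) ys)) ≡ u x * ∑v
  row = begin
    lsum (List.map w (List.map (f x) ys))   ≡⟨ cong lsum (sym (map-∘ ys)) ⟩
    lsum (List.map (λ y → w (f x y)) ys)    ≡⟨ cong lsum (map-cong (w≡u*v x) ys) ⟩
    lsum (List.map (λ y → u x * v y) ys)    ≡⟨ sum-map-*ˡ (u x) v ys ⟩
    u x * ∑v                                ∎

sum-allVecs-∏ : ∀ {q} m (g : Fin m → Fin q → ℕ) →
  lsum (List.map (λ f → ∏ (λ k → g k (lookup f k))) (allVecs q m)) ≡ ∏ (λ k → ∑ (g k))
sum-allVecs-∏         zero    g = refl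
sum-allVecs-∏ {q = q} (suc m) g = begin
  lsum (List.map (λ f → ∏ (λ k → g k (lookup f k))) (cartesianProductWith _∷_ (allFin q) (allVecs q m)))
    ≡⟨ sum-cartesianProductWith _∷_ _ (g zero) _ (λ _ _ → refl) (allFin q) (allVecs q m) ⟩
  lsum (List.map (g zero) (allFin q)) * lsum (List.map (λ f → ∏ (λ k → g (suc k) (lookup f k))) (allVecs q m))
    ≡⟨ cong₂ _*_ (sum-map-allFin (g zero)) (sum-allVecs-∏ m (λ k → g (suc k))) ⟩
  ∑ (g zero) * ∏ (λ k → ∑ (g (suc k))) ∎
  where open ≡-Reasoning

-- The exponent of y_{i,k} in ∏_{k<m} y_{f k, k}; the last column k = m never occurs.
exponent : ∀ {q m} → Vec (Fin q) m → Fin q → Fin (suc m) → ℕ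
exponent []      i zero    = 0
exponent (r ∷ f) i zero    = δ i r
exponent (r ∷ f) i (suc k) = exponent f i k

choiceMonomial : ∀ {q m} → Vec (Fin q) m → Vec (Vec ℕ (suc m)) q
choiceMonomial f = tabulate λ i → tabulate λ k → exponent f i k

lookup-choiceMonomial : ∀ {q m} (f : Vec (Fin q) m) i k → lookup (lookup (choiceMonomial f) i) k ≡ exponent f i k
lookup-choiceMonomial f i k =
  trans (cong (λ row → lookup row k) (lookup∘tabulate _ i)) (lookup∘tabulate (exponent f i) k)

exponent-injective : ∀ {q m} (f g : Vec (Fin q) m) → (∀ i k → exponent f i k ≡ exponent g i k) → f ≡ g
exponent-injective []      []      _ = refl
exponent-injective (r ∷ f) (s ∷ g) e =
  cong₂ _∷_ (δ≡1⇒≡ (trans (sym (e r zero)) (δ-diag r))) (exponent-injective f g (λ i k → e i (suc k)))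

choiceMonomial-injective : ∀ {q m} {f g : Vec (Fin q) m} → choiceMonomial f ≡ choiceMonomial g → f ≡ g
choiceMonomial-injective {f = f} {g} eq = exponent-injective f g λ i k → begin
  exponent f i k                              ≡⟨ sym (lookup-choiceMonomial f i k) ⟩
  lookup (lookup (choiceMonomial f) i) k      ≡⟨ cong (λ M → lookup (lookup M i) k) eq ⟩
  lookup (lookup (choiceMonomial g) i) k      ≡⟨ lookup-choiceMonomial g i k ⟩
  exponent g i k                              ∎
  where open ≡-Reasoning

∑-∑-exponent : ∀ {q m} (f : Vec (Fin q) m) → ∑ (λ k → ∑ (λ i → exponent f i k)) ≡ m
∑-∑-exponent {q} []      = trans (+-identityʳ _) (Sum.sum-replicate-zero q)
∑-∑-exponent     (r ∷ f) = cong₂ _+_ (∑-δ r) (∑-∑-exponent f)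

monDeg-choiceMonomial : ∀ {m} (f : Vec (Fin (suc m)) m) → monDeg (choiceMonomial f) ≡ m
monDeg-choiceMonomial f = begin
  vsum (Vec.map vsum (tabulate λ i → tabulate λ k → exponent f i k))
    ≡⟨ cong vsum (sym (tabulate-∘ vsum (λ i → tabulate (exponent f i)))) ⟩
  vsum (tabulate λ i → vsum (tabulate λ k → exponent f i k))
    ≡⟨ foldr-tabulate _+_ 0 (λ i → vsum (tabulate (exponent f i))) ⟩
  ∑ (λ i → vsum (tabulate λ k → exponent f i k))
    ≡⟨ Sum.sum-cong-≗ (λ i → foldr-tabulate _+_ 0 (exponent f i)) ⟩
  ∑ (λ i → ∑ (λ k → exponent f i k))
    ≡⟨ Sum.∑-comm (exponent f) ⟩
  ∑ (λ k → ∑ (λ i → exponent f i k))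
    ≡⟨ ∑-∑-exponent f ⟩
  _ ∎
  where open ≡-Reasoning

∏-∏-^-exponent : ∀ {q m} (g : Fin q → Fin (suc m) → ℕ) (f : Vec (Fin q) m) →
  ∏ (λ k → ∏ (λ i → g i k ^ exponent f i k)) ≡ ∏ (λ k → g (lookup f k) (inject₁ k))
∏-∏-^-exponent {q} g []      = trans (*-identityʳ _) (Prod.sum-replicate-zero q)
∏-∏-^-exponent     g (r ∷ f) =
  cong₂ _*_ (∏-^-δ (λ i → g i zero) r) (∏-∏-^-exponent (λ i k → g i (suc k)) f)

evalMon-choiceMonomial : ∀ {m} (y : Assignment (suc m)) (f : Vec (Fin (suc m)) m) →
  evalMon y (choiceMonomial f) ≡ ∏ (λ k → val (y (lookup f k) (inject₁ k)))
evalMon-choiceMonomial y f = begin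
  vprod (tabulate λ i → vprod (tabulate λ k → val (y i k) ^ lookup (lookup (choiceMonomial f) i) k))
    ≡⟨ foldr-tabulate _*_ 1 (λ i → vprod (tabulate λ k → val (y i k) ^ lookup (lookup (choiceMonomial f) i) k)) ⟩
  ∏ (λ i → vprod (tabulate λ k → val (y i k) ^ lookup (lookup (choiceMonomial f) i) k))
    ≡⟨ Prod.sum-cong-≗ (λ i → trans (foldr-tabulate _*_ 1 (λ k → val (y i k) ^ lookup (lookup (choiceMonomial f) i) k))
         (Prod.sum-cong-≗ (λ k → cong (val (y i k) ^_) (lookup-choiceMonomial f i k)))) ⟩
  ∏ (λ i → ∏ (λ k → val (y i k) ^ exponent f i k))
    ≡⟨ Prod.∑-comm (λ i k → val (y i k) ^ exponent f i k) ⟩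
  ∏ (λ k → ∏ (λ i → val (y i k) ^ exponent f i k))
    ≡⟨ ∏-∏-^-exponent (λ i k → val (y i k)) f ⟩
  ∏ (λ k → val (y (lookup f k) (inject₁ k))) ∎
  where open ≡-Reasoning

∏-odd⇔ : ∀ {n} (f : Fin n → ℕ) → Odd (∏ f) ⇔ (∀ k → Odd (f k))
∏-odd⇔ f = mk⇔ (∏-odd⁻ f) (∏-odd⁺ f)

choicePolynomial : ∀ n → Poly (suc n)
choicePolynomial n = List.map choiceMonomial (allVecs (suc n) n)

choicePolynomial-degree : ∀ n → HasDegree (choicePolynomial n) n
choicePolynomial-degree n =
  map⁺ choiceMonomial-injective (allVecs-unique (suc n) n) ,
  All.map⁺ (All.universal (λ f → ≤-reflexive (monDeg-choiceMonomial f)) (allVecs (suc n) n)) ,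
  lose (∈-map⁺ choiceMonomial (∈-allVecs (Vec.replicate n zero))) (monDeg-choiceMonomial (Vec.replicate n zero))

columnSum : ∀ {q l} → (Fin q → Fin l → Bool) → Fin l → ℕ
columnSum y k = ∑ (λ i → val (y i k))

evalPoly-choicePolynomial : ∀ {n} (y : Assignment (suc n)) →
  evalPoly y (choicePolynomial n) ≡ ∏ (λ k → columnSum y (inject₁ k))
evalPoly-choicePolynomial {n} y = begin
  lsum (List.map (evalMon y) (List.map choiceMonomial vs))
    ≡⟨ cong lsum (sym (map-∘ vs)) ⟩
  lsum (List.map (λ f → evalMon y (choiceMonomial f)) vs)
    ≡⟨ cong lsum (map-cong (evalMon-choiceMonomial y) vs) ⟩
  lsum (List.map (λ f → ∏ (λ k → val (y (lookup f k) (inject₁ k)))) vs)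
    ≡⟨ sum-allVecs-∏ n (λ k i → val (y i (inject₁ k))) ⟩
  ∏ (λ k → columnSum y (inject₁ k)) ∎
  where
  open ≡-Reasoning
  vs = allVecs (suc n) n

∑-columnSum-≤ : ∀ {q} (y : Assignment q) → PartialChoice y → ∑ (columnSum y) ≤ q
∑-columnSum-≤ y pc = begin
  ∑ (λ k → ∑ (λ i → val (y i k)))  ≡⟨ sym (Sum.∑-comm (λ i k → val (y i k))) ⟩
  ∑ (λ i → ∑ (λ k → val (y i k)))  ≤⟨ ∑-≤-card _ (λ i → ≤-trans (≤-reflexive (sym (foldr-tabulate _+_ 0 (λ k → val (y i k))))) (pc i)) ⟩
  _                                ∎
  where open ≤-Reasoning

∑-≥-entry : ∀ {m} (f : Fin (suc m) → ℕ) → (∀ i → 1 ≤ f i) → ∀ j → f j + m ≤ ∑ f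
∑-≥-entry {m} f 1≤f j = begin
  f j + m                         ≤⟨ +-monoʳ-≤ (f j) (∑-≥-card (Vector.removeAt f j) (λ i → 1≤f (punchIn j i))) ⟩
  f j + ∑ (Vector.removeAt f j)   ≡⟨ sym (Sum.sum-remove f) ⟩
  ∑ f                             ∎
  where open ≤-Reasoning

∑-≥-oddPeak : ∀ {n} (f : Fin n → ℕ) → (∀ i → Odd (f i)) → ∀ j → 2 ≤ f j → 2 + n ≤ ∑ f
∑-≥-oddPeak {suc m} f odd j 2≤fj =
  ≤-trans (+-monoˡ-≤ m (odd-≥2⇒≥3 (odd j) 2≤fj)) (∑-≥-entry f (λ i → odd⇒pos (odd i)) j)

∑-≥-oddInit : ∀ {n} (c : Fin (suc n) → ℕ) → (∀ j → Odd (c (inject₁ j))) → ∀ k → 2 ≤ c k → 2 + n ≤ ∑ c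
∑-≥-oddInit {n} c odd k 2≤ck = ≤-trans (bound k 2≤ck) (≤-reflexive (sym (Sum.sum-init-last c)))
  where
  init = λ j → c (inject₁ j)
  bound : ∀ k → 2 ≤ c k → 2 + n ≤ ∑ init + c (fromℕ n)
  bound k 2≤ck with view k
  ... | ‵fromℕ     = ≤-trans (≤-reflexive (+-comm 2 n))
                       (+-mono-≤ (∑-≥-card init (λ j → odd⇒pos (odd j))) 2≤ck)
  ... | ‵inject₁ j = ≤-trans (∑-≥-oddPeak init odd j 2≤ck) (m≤m+n _ _)

module _ {n} (y : Assignment (suc n)) where

  OddColumns : Set
  OddColumns = ∀ j → Odd (columnSum y (inject₁ j))

  oddColumns⇒cond2 : OddColumns → Cond2 y
  oddColumns⇒cond2 odd k (s≤s k<n) with view k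
  ... | ‵fromℕ     = ⊥-elim (<-irrefl (toℕ-fromℕ n) k<n)
  ... | ‵inject₁ j with ∑-pos (λ i → val (y i (inject₁ j))) (odd⇒pos (odd j))
  ...   | i , yij>0 = i , val-pos⇒true yij>0

  oddColumns⇒cond1 : PartialChoice y → OddColumns → Cond1 y
  oddColumns⇒cond1 pc odd (i , j , k , i≢j , yik , yjk) = <-irrefl refl (≤-trans too-many (∑-columnSum-≤ y pc))
    where
    two : 2 ≤ columnSum y k
    two = ≤-trans (≤-reflexive (cong₂ (λ a b → val a + val b) (sym yik) (sym yjk))) (+-≤-∑ (λ i → val (y i k)) i≢j)
    too-many : 2 + n ≤ ∑ (columnSum y)
    too-many = ∑-≥-oddInit (columnSum y) odd k two

  conds⇒oddColumns : Cond1 y → Cond2 y → OddColumns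
  conds⇒oddColumns cond1 cond2 j with cond2 (inject₁ j) (s≤s (≤-trans (≤-reflexive (cong suc (toℕ-inject₁ j))) (toℕ<n j)))
  ... | i , yij = cong (_% 2) (∑-val-unique (λ i → y i (inject₁ j)) i yij unique)
    where
    unique : ∀ i′ → y i′ (inject₁ j) ≡ true → i′ ≡ i
    unique i′ yi′j with i′ ≟ i
    ... | yes i′≡i = i′≡i
    ... | no  i′≢i = ⊥-elim (cond1 (i′ , i , inject₁ j , i′≢i , yi′j , yij))

  oddColumns⇔conds : PartialChoice y → OddColumns ⇔ (Cond1 y × Cond2 y)
  oddColumns⇔conds pc = mk⇔ (λ odd → oddColumns⇒cond1 pc odd , oddColumns⇒cond2 odd)
                            (λ (cond1 , cond2) → conds⇒oddColumns cond1 cond2)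

lemma13 : (q : ℕ) → 0 < q →
    Σ (Poly q) λ p → HasDegree p (q ∸ 1) ×
      ((y : Assignment q) → PartialChoice y →
        (evalPoly y p % 2 ≡ 1 ⇔ (Cond1 y × Cond2 y)))
lemma13 (suc n) _ = choicePolynomial n , choicePolynomial-degree n , λ y pc →
  subst (λ v → Odd v ⇔ (Cond1 y × Cond2 y)) (sym (evalPoly-choicePolynomial y))
    (oddColumns⇔conds y pc ⇔-∘ ∏-odd⇔ (λ k → columnSum y (inject₁ k)))
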